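{- For any $s\in S^c$, $i\in\mathbf{Ag}$, formula $\psi$ and $d\in\mathbf{D}$: if $\neg\nabla_i(\psi,d)\in\Gamma_s$, then there exist $t_1,t_2\in S^c$ with $\psi\in\Gamma_{t_1}$, $\psi\in\Gamma_{t_2}$, $sR^c_it_1$, $sR^c_it_2$, and $f_{t_1}(d)\neq f_{t_2}(d)$.
   Context: Language $\mathcal{L}$: fix countably infinite sets $\mathbf{P}$ (proposition letters), $\mathbf{Ag}$ (agents), $\mathbf{D}$ (constant symbols); formulas $\phi ::= \top\mid p\mid\neg\phi\mid(\phi\wedge\phi)\mid\Box_i\phi\mid\nabla_i(\phi,d)$, with $\Diamond_i\phi:=\neg\Box_i\neg\phi$ and usual Boolean abbreviations. Proof system $\mathbf{SLKvr}$: axioms all tautologies; $\Box_i(\phi\to\psi)\to(\Box_i\phi\to\Box_i\psi)$; $\Box_i(\phi\to\psi)\to(\nabla_i(\psi,d)\to\nabla_i(\phi,d))$; $\nabla_i(\bot,d)$; $\Diamond_i(\phi\wedge\psi)\wedge\nabla_i(\phi,d)\wedge\nabla_i(\psi,d)\to\nabla_i(\phi\vee\psi,d)$; rules modus ponens, necessitation for $\Box_i$, and replacement of provable equivalents. Canonical structure: $S^c$ is the set of all triples $\langle\Gamma,f,g\rangle$ where $\Gamma$ is a maximal $\mathbf{SLKvr}$-consistent set, $f:\mathbf{D}\to\mathbb{N}$, $g:\mathbf{Ag}\times\mathcal{L}\times\mathbf{D}\to\mathbb{N}\cup\{*\}$ (with $*\notin\mathbb{N}$), such that for all $i,\phi,\psi,d$: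 (1) $g(i,\phi,d)\neq *$ iff $\nabla_i(\phi,d)\wedge\Diamond_i\phi\in\Gamma$; (2) if $g(i,\phi,d)\neq*$ and $g(i,\psi,d)\neq*$ then: $g(i,\phi,d)=g(i,\psi,d)$ iff $\nabla_i(\phi\vee\psi,d)\in\Gamma$. For $s\in S^c$ write $s=\langle\Gamma_s,f_s,g_s\rangle$. For $s,t\in S^c$, $sR^c_it$ iff (3) $\{\phi\mid\Box_i\phi\in\Gamma_s\}\subseteq\Gamma_t$ and (4) whenever $\nabla_i(\phi,d)\in\Gamma_s$ and $\phi\in\Gamma_t$, $f_t(d)=g_s(i,\phi,d)$. -}

module Defs where

open import Data.Nat using (ℕ)
open import Data.Bool using (Bool; true; false; not; _∧_)
open import Data.List using (List; []; _∷_)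
open import Data.List.Relation.Unary.All using (All)
open import Data.Maybe using (Maybe; just; nothing)
open import Data.Product using (Σ; _×_; _,_)
open import Data.Sum using (_⊎_)
open import Relation.Binary.PropositionalEquality using (_≡_)
open import Relation.Nullary using (¬_)
open import Function.Bundles using (_⇔_)
open import Level using (0ℓ) renaming (suc to lsuc)

Prop : Set
Prop = ℕ
Agent : Set
Agent = ℕ
Const : Set
Const = ℕ

data Form : Set where
  ⊤'  : Form
  var : Prop → Form
  ¬'_ : Form → Form
  _∧'_ : Form → Form → Form
  □   : Agent → Form → Form
  ∇   : Agent → Form → Const → Form

infixr 6 _∧'_
infixr 5 _∨'_
infixr 4 _⇒_ _⇔'_

⊥' : Form
⊥' = ¬' ⊤'

_∨'_ : Form → Form → Form
φ ∨' ψ = ¬' (¬' φ ∧' ¬' ψ)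

_⇒_ : Form → Form → Form
φ ⇒ ψ = ¬' (φ ∧' ¬' ψ)

_⇔'_ : Form → Form → Form
φ ⇔' ψ = (φ ⇒ ψ) ∧' (ψ ⇒ φ)

◇ : Agent → Form → Form
◇ i φ = ¬' □ i (¬' φ)

-- Propositional tautologies: true under every Boolean valuation, where the
-- modal formulas □_i φ and ∇_i(φ,d) are treated as propositional atoms.
record Valuation : Set where
  field
    vp : Prop → Bool
    vb : Agent → Form → Bool
    vn : Agent → Form → Const → Bool

eval : Valuation → Form → Bool
eval v ⊤' = true
eval v (var p) = Valuation.vp v p
eval v (¬' φ) = not (eval v φ)
eval v (φ ∧' ψ) = eval v φ ∧ eval v ψ
eval v (□ i φ) = Valuation.vb v i φ
eval v (∇ i φ d) = Valuation.vn v i φ d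

Tautology : Form → Set
Tautology φ = ∀ (v : Valuation) → eval v φ ≡ true

data Repl (φ ψ : Form) : Form → Form → Set where
  here : Repl φ ψ φ ψ
  neg  : ∀ {χ χ'} → Repl φ ψ χ χ' → Repl φ ψ (¬' χ) (¬' χ')
  andl : ∀ {χ χ' θ} → Repl φ ψ χ χ' → Repl φ ψ (χ ∧' θ) (χ' ∧' θ)
  andr : ∀ {χ χ' θ} → Repl φ ψ χ χ' → Repl φ ψ (θ ∧' χ) (θ ∧' χ')
  box  : ∀ {i χ χ'} → Repl φ ψ χ χ' → Repl φ ψ (□ i χ) (□ i χ')
  nab  : ∀ {i χ χ' d} → Repl φ ψ χ χ' → Repl φ ψ (∇ i χ d) (∇ i χ' d)

data ⊢_ : Form → Set where
  taut  : ∀ {φ} → Tautology φ → ⊢ φ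
  K     : ∀ {i φ ψ} → ⊢ (□ i (φ ⇒ ψ) ⇒ (□ i φ ⇒ □ i ψ))
  mono∇ : ∀ {i φ ψ d} → ⊢ (□ i (φ ⇒ ψ) ⇒ (∇ i ψ d ⇒ ∇ i φ d))
  bot∇  : ∀ {i d} → ⊢ ∇ i ⊥' d
  join∇ : ∀ {i φ ψ d} →
          ⊢ ((◇ i (φ ∧' ψ) ∧' ∇ i φ d ∧' ∇ i ψ d) ⇒ ∇ i (φ ∨' ψ) d)
  mp    : ∀ {φ ψ} → ⊢ (φ ⇒ ψ) → ⊢ φ → ⊢ ψ
  nec   : ∀ {i φ} → ⊢ φ → ⊢ □ i φ
  repl  : ∀ {φ ψ χ χ'} → ⊢ (φ ⇔' ψ) → Repl φ ψ χ χ' → ⊢ χ → ⊢ χ'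

FSet : Set₁
FSet = Form → Set

_∈_ : Form → FSet → Set
φ ∈ Γ = Γ φ

_⊆_ : FSet → FSet → Set
Γ ⊆ Δ = ∀ φ → φ ∈ Γ → φ ∈ Δ

conj : List Form → Form
conj [] = ⊤'
conj (φ ∷ φs) = φ ∧' conj φs

Consistent : FSet → Set
Consistent Γ = ¬ (Σ (List Form) λ φs → All (λ φ → φ ∈ Γ) φs × (⊢ (¬' conj φs)))

MaxCons : FSet → Set₁
MaxCons Γ = Consistent Γ × (∀ (Δ : FSet) → Γ ⊆ Δ → Consistent Δ → Δ ⊆ Γ)

-- The canonical structure. Maybe ℕ plays the role of ℕ ∪ {*}, with nothing = *.
record SC : Set₁ where
  field
    Γ    : FSet
    f    : Const → ℕ
    g    : Agent → Form → Const → Maybe ℕ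
    mcs  : MaxCons Γ
    cond1 : ∀ i φ d → (¬ (g i φ d ≡ nothing)) ⇔ ((∇ i φ d ∧' ◇ i φ) ∈ Γ)
    cond2 : ∀ i φ ψ d (n m : ℕ) → g i φ d ≡ just n → g i ψ d ≡ just m →
            (n ≡ m) ⇔ (∇ i (φ ∨' ψ) d ∈ Γ)

open SC public

Rc : Agent → SC → SC → Set
Rc i s t =
  (∀ φ → □ i φ ∈ Γ s → φ ∈ Γ t) ×
  (∀ φ d → ∇ i φ d ∈ Γ s → φ ∈ Γ t → just (f t d) ≡ g s i φ d)

-- Write Φ for {φ | □ᵢφ ∈ Γ_s} ∪ {ψ}.  Every maximal consistent Δ ⊇ Φ underlies
-- an Rᶜᵢ-successor of s containing ψ: equip Δ with the canonical g (the index
-- of φ is the least code of a ρ with ∇ᵢ(φ∨ρ,d) ∈ Δ, an equivalence on viable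
-- formulas by the ∇-axioms), and let f(d′) be the common g_s-index of the
-- φ ∈ Δ with ∇ᵢ(φ,d′) ∈ Γ_s; these indices agree because ◇ᵢ(φ∧φ′) ∈ Γ_s, so
-- the join axiom gives ∇ᵢ(φ∨φ′,d′) ∈ Γ_s.  Take such a t₁ and n = f_{t₁}(d).
-- Then Φ ∪ {¬φ | g_s(i,φ,d) = n} is still consistent: otherwise
-- □ᵢ(ψ → φ₁∨…∨φₖ) ∈ Γ_s with every φⱼ of index n; formulas of a common index
-- join to ∇ᵢ(φ₁∨…∨φₖ,d) ∈ Γ_s, and monotonicity yields ∇ᵢ(ψ,d) ∈ Γ_s.  A
-- successor t₂ built on that set, with default value n + 1, has f_{t₂}(d) ≠ n.

module Submission where

open import Defs
open import Data.Bool using (true; false; not; T)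
open import Data.Bool.Properties using (T-≡; T-∧)
open import Data.Empty using (⊥-elim)
open import Data.List using (List; []; _∷_; _++_; map; foldr)
open import Data.List.Relation.Unary.All as All using (All; []; _∷_)
open import Data.List.Relation.Unary.All.Properties using (++⁺; ++⁻ˡ; ++⁻ʳ; map⁺; ¬Any⇒All¬)
open import Data.List.Relation.Unary.Any using (Any; here; there)
open import Data.Maybe using (Maybe; just; nothing)
open import Data.Nat using (ℕ; zero; suc; _≤_; _<_; _≤′_; ≤′-refl; ≤′-step; _⊔_)
open import Data.Nat.Binary using (ℕᵇ; 2[1+_]; 1+[2_]; toℕ) renaming (zero to 0ᵇ)
open import Data.Nat.Binary.Properties using (toℕ-injective; 2[1+_]-injective)
open import Data.Nat.Induction using (<-rec)
open import Data.Nat.Properties using (≤-antisym; ≮⇒≥; ≤⇒≤′; m≤m⊔n; m≤n⊔m; 1+n≢n)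
open import Axiom.ExcludedMiddle using (ExcludedMiddle)
open import Axiom.DoubleNegationElimination using (em⇒dne)
open import Level using (0ℓ)
open import Data.Product using (Σ; ∃; _×_; _,_; proj₁; proj₂)
open import Data.Sum using (_⊎_; inj₁; inj₂; [_,_]′)
open import Data.Unit using (tt)
open import Function using (_∘_; id)
open import Function.Bundles using (_⇔_; mk⇔; Equivalence)
open import Relation.Binary.PropositionalEquality using (_≡_; refl; sym; trans; cong; subst)
open import Relation.Nullary using (¬_; Dec; yes; no)
open import Relation.Nullary.Decidable using (T?; map′; decidable-stable)

open Equivalence using (to; from)

disj : List Form → Form
disj = foldr _∨'_ ⊥'

record _⊨_ (v : Valuation) (φ : Form) : Set where
  constructor sat
  field holds : T (eval v φ)

infix 3.5 _⊨_

open _⊨_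

T-not : ∀ x → T (not x) ⇔ (¬ T x)
T-not false = mk⇔ (λ _ ()) (λ _ → tt)
T-not true  = mk⇔ (λ ()) (λ h → ⊥-elim (h tt))

module _ {v : Valuation} where

  ⊨? : ∀ φ → Dec (v ⊨ φ)
  ⊨? φ = map′ sat holds (T? (eval v φ))

  ⊨-stable : ∀ {φ} → ¬ ¬ v ⊨ φ → v ⊨ φ
  ⊨-stable {φ} = decidable-stable (⊨? φ)

  ⊨-⊤ : v ⊨ ⊤'
  ⊨-⊤ = sat tt

  ⊨-¬ : ∀ {φ} → v ⊨ ¬' φ ⇔ (¬ v ⊨ φ)
  ⊨-¬ {φ} = mk⇔ (λ (sat h) (sat k) → T-not (eval v φ) .to h k)
                 (λ h → sat (T-not (eval v φ) .from (h ∘ sat)))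

  ⊨-⊥ : ¬ v ⊨ ⊥'
  ⊨-⊥ h = ⊨-¬ .to h ⊨-⊤

  ⊨-∧ : ∀ {φ ψ} → v ⊨ φ ∧' ψ ⇔ (v ⊨ φ × v ⊨ ψ)
  ⊨-∧ {φ} = mk⇔ (λ (sat h) → let (a , b) = T-∧ {eval v φ} .to h in sat a , sat b)
                 (λ (sat a , sat b) → sat (T-∧ {eval v φ} .from (a , b)))

  ⊨-⇒ : ∀ {φ ψ} → v ⊨ φ ⇒ ψ ⇔ (v ⊨ φ → v ⊨ ψ)
  ⊨-⇒ = mk⇔ (λ h a → ⊨-stable λ ¬b → ⊨-¬ .to h (⊨-∧ .from (a , ⊨-¬ .from ¬b)))
             (λ f → ⊨-¬ .from λ k → let (a , ¬b) = ⊨-∧ .to k in ⊨-¬ .to ¬b (f a))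

  ⊨-∨ : ∀ {φ ψ} → v ⊨ φ ∨' ψ ⇔ (v ⊨ φ ⊎ v ⊨ ψ)
  ⊨-∨ {φ} {ψ} = mk⇔ to′ (λ h → ⊨-¬ .from λ k → let (¬a , ¬b) = ⊨-∧ .to k in
                                   [ ⊨-¬ .to ¬a , ⊨-¬ .to ¬b ]′ h)
    where
    to′ : v ⊨ φ ∨' ψ → v ⊨ φ ⊎ v ⊨ ψ
    to′ h with ⊨? φ
    ... | yes a = inj₁ a
    ... | no ¬a = inj₂ (⊨-stable λ ¬b → ⊨-¬ .to h (⊨-∧ .from (⊨-¬ .from ¬a , ⊨-¬ .from ¬b)))

  ⊨-conj : ∀ {l} → v ⊨ conj l ⇔ All (v ⊨_) l
  ⊨-conj {[]}    = mk⇔ (λ _ → []) (λ _ → ⊨-⊤)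
  ⊨-conj {φ ∷ l} = mk⇔ (λ h → let (a , b) = ⊨-∧ .to h in a ∷ ⊨-conj .to b)
                        (λ { (a ∷ as) → ⊨-∧ .from (a , ⊨-conj .from as) })

  ⊨-disj : ∀ {l} → v ⊨ disj l ⇔ Any (v ⊨_) l
  ⊨-disj {[]}    = mk⇔ (⊥-elim ∘ ⊨-⊥) (λ ())
  ⊨-disj {φ ∷ l} = mk⇔ (λ h → [ here , there ∘ ⊨-disj .to ]′ (⊨-∨ .to h))
                        (λ { (here a) → ⊨-∨ .from (inj₁ a) ; (there a) → ⊨-∨ .from (inj₂ (⊨-disj .from a)) })

valid : ∀ {φ} → (∀ {v} → v ⊨ φ) → ⊢ φ
valid h = taut λ v → T-≡ .to (h {v} .holds)

valid-⇒ : ∀ {φ ψ} → (∀ {v} → v ⊨ φ → v ⊨ ψ) → ⊢ (φ ⇒ ψ)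
valid-⇒ h = valid (⊨-⇒ .from h)

⊢-mp-valid : ∀ {φ ψ} → ⊢ φ → (∀ {v} → v ⊨ φ → v ⊨ ψ) → ⊢ ψ
⊢-mp-valid p h = mp (valid-⇒ h) p

_∪_ : FSet → FSet → FSet
(Γ ∪ Δ) φ = φ ∈ Γ ⊎ φ ∈ Δ

⁅_⁆ : Form → FSet
⁅ χ ⁆ φ = φ ≡ χ

infixl 5 _∪_

infix 2 _⊢ₛ_

_⊢ₛ_ : FSet → Form → Set
Γ ⊢ₛ χ = Σ (List Form) λ l → All (_∈ Γ) l × ⊢ (conj l ⇒ χ)

Inconsistent : FSet → Set
Inconsistent Γ = Σ (List Form) λ l → All (_∈ Γ) l × ⊢ (¬' conj l)

consistent-⊆ : ∀ {Γ Δ} → Γ ⊆ Δ → Consistent Δ → Consistent Γ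
consistent-⊆ Γ⊆Δ cΔ (l , l⊆Γ , p) = cΔ (l , All.map (Γ⊆Δ _) l⊆Γ , p)

⊢ₛ-contradiction : ∀ {Γ χ} → Γ ⊢ₛ χ → Γ ⊢ₛ ¬' χ → Inconsistent Γ
⊢ₛ-contradiction (l₁ , l₁⊆Γ , p₁) (l₂ , l₂⊆Γ , p₂) =
  l₁ ++ l₂ , ++⁺ l₁⊆Γ l₂⊆Γ , mp (mp (valid-⇒ λ a → ⊨-⇒ .from λ b → ⊨-¬ .from λ c →
    let cs = ⊨-conj .to c
    in ⊨-¬ .to (⊨-⇒ .to b (⊨-conj .from (++⁻ʳ l₁ cs))) (⊨-⇒ .to a (⊨-conj .from (++⁻ˡ l₁ cs)))) p₁) p₂

split-∪ : ∀ {P Q : Form → Set} {l} → All (λ φ → P φ ⊎ Q φ) l →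
          Σ (List Form) λ lp → Σ (List Form) λ lq → All P lp × All Q lq ×
            (∀ {R : Form → Set} → All R lp → All R lq → All R l)
split-∪ [] = [] , [] , [] , [] , λ _ _ → []
split-∪ (inj₁ p ∷ ps) with split-∪ ps
... | lp , lq , aP , aQ , back = _ ∷ lp , lq , p ∷ aP , aQ , λ { (r ∷ rp) rq → r ∷ back rp rq }
split-∪ (inj₂ q ∷ ps) with split-∪ ps
... | lp , lq , aP , aQ , back = lp , _ ∷ lq , aP , q ∷ aQ , λ { rp (r ∷ rq) → r ∷ back rp rq }

All-⁅⁆ : ∀ {χ} {R : Form → Set} {l} → All ⁅ χ ⁆ l → R χ → All R l
All-⁅⁆ {R = R} eqs r = All.map (λ e → subst R (sym e) r) eqs

inconsistent-∪⁅⁆ : ∀ {Γ χ} → Inconsistent (Γ ∪ ⁅ χ ⁆) → Γ ⊢ₛ ¬' χ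
inconsistent-∪⁅⁆ (l , l⊆ , p) with split-∪ l⊆
... | lΓ , lχ , lΓ⊆Γ , lχ≡χ , back =
  lΓ , lΓ⊆Γ , ⊢-mp-valid p λ h → ⊨-⇒ .from λ c → ⊨-¬ .from λ x →
    ⊨-¬ .to h (⊨-conj .from (back (⊨-conj .to c) (All-⁅⁆ lχ≡χ x)))

unbox : Agent → FSet → FSet
unbox i Γ φ = □ i φ ∈ Γ

module MaxConsistent {Γ : FSet} (mc : MaxCons Γ) where

  ⊢ₛ⇒∈ : ∀ {χ} → Γ ⊢ₛ χ → χ ∈ Γ
  ⊢ₛ⇒∈ {χ} Γ⊢χ = proj₂ mc (Γ ∪ ⁅ χ ⁆) (λ _ → inj₁) consistent χ (inj₂ refl)
    where
    consistent : Consistent (Γ ∪ ⁅ χ ⁆)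
    consistent inc = proj₁ mc (⊢ₛ-contradiction Γ⊢χ (inconsistent-∪⁅⁆ inc))

  ∈-valid : ∀ {l χ} → All (_∈ Γ) l → (∀ {v} → All (v ⊨_) l → v ⊨ χ) → χ ∈ Γ
  ∈-valid l⊆Γ h = ⊢ₛ⇒∈ (_ , l⊆Γ , valid-⇒ (h ∘ ⊨-conj .to))

  ⊢⇒∈ : ∀ {χ} → ⊢ χ → χ ∈ Γ
  ⊢⇒∈ p = ⊢ₛ⇒∈ ([] , [] , ⊢-mp-valid p λ x → ⊨-⇒ .from λ _ → x)

  ∈-mp : ∀ {α β} → (α ⇒ β) ∈ Γ → α ∈ Γ → β ∈ Γ
  ∈-mp a b = ∈-valid (a ∷ b ∷ []) λ { (x ∷ y ∷ []) → ⊨-⇒ .to x y }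

  ∈-∧ : ∀ {α β} → (α ∧' β) ∈ Γ ⇔ (α ∈ Γ × β ∈ Γ)
  ∈-∧ = mk⇔ (λ h → ∈-valid (h ∷ []) (λ { (x ∷ []) → proj₁ (⊨-∧ .to x) })
             , ∈-valid (h ∷ []) (λ { (x ∷ []) → proj₂ (⊨-∧ .to x) }))
            (λ (a , b) → ∈-valid (a ∷ b ∷ []) λ { (x ∷ y ∷ []) → ⊨-∧ .from (x , y) })

  ∈-¬ : ∀ {φ} → (¬' φ) ∈ Γ → ¬ φ ∈ Γ
  ∈-¬ {φ} n a = proj₁ mc (_ , a ∷ n ∷ [] , valid λ {v} → ⊨-¬ .from λ c → contradiction (⊨-conj .to c))
    where
    contradiction : ∀ {v} → ¬ All (v ⊨_) (φ ∷ ¬' φ ∷ [])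
    contradiction (x ∷ y ∷ []) = ⊨-¬ .to y x

  □-mp : ∀ {i α β} → □ i (α ⇒ β) ∈ Γ → □ i α ∈ Γ → □ i β ∈ Γ
  □-mp a b = ∈-mp (∈-mp (⊢⇒∈ K) a) b

  □-mono : ∀ {i α β} → ⊢ (α ⇒ β) → □ i α ∈ Γ → □ i β ∈ Γ
  □-mono p = □-mp (⊢⇒∈ (nec p))

  □-conj : ∀ {i l} → All (unbox i Γ) l → □ i (conj l) ∈ Γ
  □-conj []       = ⊢⇒∈ (nec (valid ⊨-⊤))
  □-conj (a ∷ as) = □-mp (□-mono (valid-⇒ λ x → ⊨-⇒ .from λ y → ⊨-∧ .from (x , y)) a) (□-conj as)

  ◇-mono : ∀ {i α β} → ⊢ (α ⇒ β) → ◇ i α ∈ Γ → ◇ i β ∈ Γ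
  ◇-mono {i} {α} {β} p ◇α = ∈-valid (K′ ∷ ◇α ∷ [])
    λ { (k ∷ x ∷ []) → ⊨-¬ .from λ y → ⊨-¬ .to x (⊨-⇒ .to k y) }
    where
    K′ : (□ i (¬' β) ⇒ □ i (¬' α)) ∈ Γ
    K′ = ∈-mp (⊢⇒∈ K) (⊢⇒∈ (nec (⊢-mp-valid p λ h → ⊨-⇒ .from λ ¬b →
           ⊨-¬ .from λ a → ⊨-¬ .to ¬b (⊨-⇒ .to h a))))

  ∇-antitone-□ : ∀ {i α β d} → □ i (α ⇒ β) ∈ Γ → ∇ i β d ∈ Γ → ∇ i α d ∈ Γ
  ∇-antitone-□ □α⇒β = ∈-mp (∈-mp (⊢⇒∈ mono∇) □α⇒β)

  ∇-antitone : ∀ {i α β d} → ⊢ (α ⇒ β) → ∇ i β d ∈ Γ → ∇ i α d ∈ Γ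
  ∇-antitone p = ∇-antitone-□ (⊢⇒∈ (nec p))

  ∇-join : ∀ {i α β d} → ◇ i (α ∧' β) ∈ Γ → ∇ i α d ∈ Γ → ∇ i β d ∈ Γ → ∇ i (α ∨' β) d ∈ Γ
  ∇-join a b c = ∈-mp (⊢⇒∈ join∇) (∈-∧ .from (a , ∈-∧ .from (b , c)))

  ∇-glue : ∀ {i α β γ d} → ◇ i β ∈ Γ → ∇ i (α ∨' β) d ∈ Γ → ∇ i (β ∨' γ) d ∈ Γ →
           ∇ i (α ∨' β ∨' γ) d ∈ Γ
  ∇-glue ◇β αβ βγ = ∇-antitone (valid-⇒ λ h → ⊨-∨ .from ([ inj₁ ∘ ⊨-∨ .from ∘ inj₁ , inj₂ ]′ (⊨-∨ .to h)))
    (∇-join (◇-mono (valid-⇒ λ b → ⊨-∧ .from (⊨-∨ .from (inj₂ b) , ⊨-∨ .from (inj₁ b))) ◇β) αβ βγ)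

  unbox-inconsistent : ∀ {i Δ} → Inconsistent (unbox i Γ ∪ Δ) →
                       Σ (List Form) λ l → All (_∈ Δ) l × □ i (¬' conj l) ∈ Γ
  unbox-inconsistent (l , l⊆ , p) with split-∪ l⊆
  ... | lb , lΔ , lb⊆ , lΔ⊆Δ , back = lΔ , lΔ⊆Δ , □-mono
        (⊢-mp-valid p λ h → ⊨-⇒ .from λ b → ⊨-¬ .from λ c →
           ⊨-¬ .to h (⊨-conj .from (back (⊨-conj .to b) (⊨-conj .to c))))
        (□-conj lb⊆)

-- Index classes of a canonical state

Negations : (Form → Set) → FSet
Negations X χ = ∃ λ φ → X φ × χ ≡ ¬' φ

All-Negations : ∀ {X l} → All (Negations X) l → ∃ λ l′ → All X l′ × l ≡ map ¬'_ l′
All-Negations []                   = [] , [] , refl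
All-Negations ((φ , x , refl) ∷ xs) with All-Negations xs
... | l′ , xs′ , refl = φ ∷ l′ , x ∷ xs′ , refl

module IndexClass (s : SC) (i : Agent) (d : Const) where
  open MaxConsistent (mcs s)

  HasIndex : ℕ → Form → Set
  HasIndex n φ = g s i φ d ≡ just n

  HasIndex-viable : ∀ {n φ} → HasIndex n φ → (∇ i φ d ∧' ◇ i φ) ∈ Γ s
  HasIndex-viable {n} {φ} gφ = cond1 s i φ d .to λ g≡nothing → just≢nothing (trans (sym gφ) g≡nothing)
    where
    just≢nothing : ¬ just n ≡ nothing
    just≢nothing ()

  ∇-disj-HasIndex : ∀ {n l} → All (HasIndex n) l → ∇ i (disj l) d ∈ Γ s
  ∇-disj-HasIndex [] = ⊢⇒∈ bot∇
  ∇-disj-HasIndex (gφ ∷ []) =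
    ∇-antitone (valid-⇒ λ h → [ id , ⊥-elim ∘ ⊨-⊥ ]′ (⊨-∨ .to h)) (proj₁ (∈-∧ .to (HasIndex-viable gφ)))
  ∇-disj-HasIndex {n} {φ ∷ ρ ∷ _} (gφ ∷ gρ ∷ gs) =
    ∇-glue (proj₂ (∈-∧ .to (HasIndex-viable gρ))) (cond2 s i φ ρ d n n gφ gρ .to refl)
           (∇-disj-HasIndex (gρ ∷ gs))

  candidate-consistent : ∀ {ψ} n → (¬' ∇ i ψ d) ∈ Γ s →
                         Consistent (unbox i (Γ s) ∪ (⁅ ψ ⁆ ∪ Negations (HasIndex n)))
  candidate-consistent {ψ} n ¬∇ψ inc with unbox-inconsistent inc
  ... | l , l⊆ , □¬l with split-∪ l⊆
  ... | lψ , lneg , lψ≡ψ , lneg⊆ , back with All-Negations lneg⊆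
  ... | lX , lX-indexed , refl = ∈-¬ ¬∇ψ (∇-antitone-□ □ψ⇒disj (∇-disj-HasIndex lX-indexed))
    where
    □ψ⇒disj : □ i (ψ ⇒ disj lX) ∈ Γ s
    □ψ⇒disj = □-mono (valid-⇒ λ h → ⊨-⇒ .from λ x → ⊨-stable λ ¬disj → ⊨-¬ .to h (⊨-conj .from
                (back (All-⁅⁆ lψ≡ψ x) (map⁺ (All.map (⊨-¬ .from) (¬Any⇒All¬ lX (¬disj ∘ ⊨-disj .from)))))))
             □¬l

-- Gödel numbering of formulas

unary : ℕ → ℕᵇ → ℕᵇ
unary zero    b = 1+[2 b ]
unary (suc n) b = 2[1+ unary n b ]

unary-injective : ∀ m n {b c} → unary m b ≡ unary n c → m ≡ n × b ≡ c
unary-injective zero    zero    refl = refl , refl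
unary-injective (suc m) (suc n) e with unary-injective m n (2[1+_]-injective e)
... | refl , refl = refl , refl

tag : Form → ℕ
tag ⊤'        = 0
tag (var _)   = 1
tag (¬' _)    = 2
tag (_ ∧' _)  = 3
tag (□ _ _)   = 4
tag (∇ _ _ _) = 5

-- The tag is emitted first, so that encode-injective can peel it off before
-- inspecting the formulas.
mutual
  encode : Form → ℕᵇ → ℕᵇ
  encode φ b = unary (tag φ) (fields φ b)

  fields : Form → ℕᵇ → ℕᵇ
  fields ⊤'        b = b
  fields (var p)   b = unary p b
  fields (¬' φ)    b = encode φ b
  fields (φ ∧' ψ)  b = encode φ (encode ψ b)
  fields (□ i φ)   b = unary i (encode φ b)
  fields (∇ i φ d) b = unary i (encode φ (unary d b))

encode-injective : ∀ φ ψ {b c} → encode φ b ≡ encode ψ c → φ ≡ ψ × b ≡ c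
encode-injective φ ψ e with unary-injective (tag φ) (tag ψ) e
encode-injective ⊤' ⊤' e | refl , e₁ = refl , e₁
encode-injective (var p) (var q) e | refl , e₁ with unary-injective p q e₁
... | refl , e₂ = refl , e₂
encode-injective (¬' φ) (¬' ψ) e | refl , e₁ with encode-injective φ ψ e₁
... | refl , e₂ = refl , e₂
encode-injective (φ₁ ∧' φ₂) (ψ₁ ∧' ψ₂) e | refl , e₁ with encode-injective φ₁ ψ₁ e₁
... | refl , e₂ with encode-injective φ₂ ψ₂ e₂
... | refl , e₃ = refl , e₃
encode-injective (□ i φ) (□ j ψ) e | refl , e₁ with unary-injective i j e₁
... | refl , e₂ with encode-injective φ ψ e₂
... | refl , e₃ = refl , e₃
encode-injective (∇ i φ d) (∇ j ψ d′) e | refl , e₁ with unary-injective i j e₁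
... | refl , e₂ with encode-injective φ ψ e₂
... | refl , e₃ with unary-injective d d′ e₃
... | refl , e₄ = refl , e₄

code : Form → ℕ
code φ = toℕ (encode φ 0ᵇ)

code-injective : ∀ φ ψ → code φ ≡ code ψ → φ ≡ ψ
code-injective φ ψ e = proj₁ (encode-injective φ ψ (toℕ-injective e))

Least : (ℕ → Set) → ℕ → Set
Least P m = P m × (∀ k → P k → m ≤ k)

Least-unique : ∀ {P Q : ℕ → Set} {m n} → (∀ {k} → P k → Q k) → (∀ {k} → Q k → P k) →
               Least P m → Least Q n → m ≡ n
Least-unique P⇒Q Q⇒P (pm , m-least) (qn , n-least) = ≤-antisym (m-least _ (Q⇒P qn)) (n-least _ (P⇒Q pm))

-- Lindenbaum extensions and canonical successors

module Classical (em : ExcludedMiddle 0ℓ) where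

  decode : ℕ → Form
  decode n with em {∃ λ φ → code φ ≡ n}
  ... | yes (φ , _) = φ
  ... | no _        = ⊤'

  decode-code : ∀ φ → decode (code φ) ≡ φ
  decode-code φ with em {∃ λ ψ → code ψ ≡ code φ}
  ... | yes (ψ , e) = code-injective ψ φ e
  ... | no ∄        = ⊥-elim (∄ (φ , refl))

  least : ∀ {P : ℕ → Set} n → P n → ∃ (Least P)
  least {P} = <-rec (λ n → P n → ∃ (Least P)) search
    where
    search : ∀ n → (∀ {k} → k < n → P k → ∃ (Least P)) → P n → ∃ (Least P)
    search n below pn with em {∃ λ k → k < n × P k}
    ... | yes (k , k<n , pk) = below k<n pk
    ... | no ∄               = n , pn , λ k pk → ≮⇒≥ λ k<n → ∄ (k , k<n , pk)

  ∈-complete : ∀ {Γ} → MaxCons Γ → ∀ φ → φ ∈ Γ ⊎ (¬' φ) ∈ Γ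
  ∈-complete {Γ} mc φ with em {Consistent (Γ ∪ ⁅ φ ⁆)}
  ... | yes c = inj₁ (proj₂ mc _ (λ _ → inj₁) c φ (inj₂ refl))
  ... | no ¬c = inj₂ (MaxConsistent.⊢ₛ⇒∈ mc (inconsistent-∪⁅⁆ (em⇒dne em ¬c)))

  module Lindenbaum {Σ₀ : FSet} (c₀ : Consistent Σ₀) where

    stage : ℕ → FSet
    stage zero    = Σ₀
    stage (suc n) = stage n ∪ λ φ → φ ≡ decode n × Consistent (stage n ∪ ⁅ decode n ⁆)

    stage-consistent : ∀ n → Consistent (stage n)
    stage-consistent zero = c₀
    stage-consistent (suc n) with em {Consistent (stage n ∪ ⁅ decode n ⁆)}
    ... | yes c = consistent-⊆ (λ _ → [ inj₁ , inj₂ ∘ proj₁ ]′) c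
    ... | no ¬c = consistent-⊆ (λ _ → [ id , ⊥-elim ∘ ¬c ∘ proj₂ ]′) (stage-consistent n)

    stage-mono : ∀ {m n} → m ≤′ n → stage m ⊆ stage n
    stage-mono ≤′-refl        _ x = x
    stage-mono (≤′-step m≤n) φ x = inj₁ (stage-mono m≤n φ x)

    limit : FSet
    limit φ = ∃ λ n → φ ∈ stage n

    finite-⊆-stage : ∀ {l} → All (_∈ limit) l → ∃ λ N → All (_∈ stage N) l
    finite-⊆-stage []             = 0 , []
    finite-⊆-stage ((n , x) ∷ xs) with finite-⊆-stage xs
    ... | N , xs′ = n ⊔ N , stage-mono (≤⇒≤′ (m≤m⊔n n N)) _ x ∷ All.map (stage-mono (≤⇒≤′ (m≤n⊔m n N)) _) xs′

    limit-consistent : Consistent limit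
    limit-consistent (l , l⊆ , p) with finite-⊆-stage l⊆
    ... | N , l⊆N = stage-consistent N (l , l⊆N , p)

    limit-maximal : ∀ Δ → limit ⊆ Δ → Consistent Δ → Δ ⊆ limit
    limit-maximal Δ limit⊆Δ cΔ φ φ∈Δ = suc (code φ) , inj₂ (sym (decode-code φ) , admissible)
      where
      admissible : Consistent (stage (code φ) ∪ ⁅ decode (code φ) ⁆)
      admissible rewrite decode-code φ =
        consistent-⊆ (λ _ → [ (λ x → limit⊆Δ _ (code φ , x)) , (λ { refl → φ∈Δ }) ]′) cΔ

  lindenbaum : ∀ {Σ₀} → Consistent Σ₀ → Σ FSet λ Δ → Σ₀ ⊆ Δ × MaxCons Δ
  lindenbaum c₀ = limit , (λ _ x → 0 , x) , limit-consistent , limit-maximal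
    where open Lindenbaum c₀

  module CanonicalIndex {Δ : FSet} (mc : MaxCons Δ) (i : Agent) (d : Const) where
    open MaxConsistent mc

    Viable : Form → Set
    Viable φ = (∇ i φ d ∧' ◇ i φ) ∈ Δ

    _∼_ : Form → Form → Set
    φ ∼ ψ = ∇ i (φ ∨' ψ) d ∈ Δ

    ∼-refl : ∀ {φ} → Viable φ → φ ∼ φ
    ∼-refl v = ∇-antitone (valid-⇒ λ h → [ id , id ]′ (⊨-∨ .to h)) (proj₁ (∈-∧ .to v))

    ∼-sym : ∀ {φ ψ} → φ ∼ ψ → ψ ∼ φ
    ∼-sym = ∇-antitone (valid-⇒ λ h → ⊨-∨ .from ([ inj₂ , inj₁ ]′ (⊨-∨ .to h)))

    ∼-trans : ∀ {φ ψ χ} → Viable ψ → φ ∼ ψ → ψ ∼ χ → φ ∼ χ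
    ∼-trans v φψ ψχ = ∇-antitone
      (valid-⇒ λ h → ⊨-∨ .from ([ inj₁ , inj₂ ∘ ⊨-∨ .from ∘ inj₂ ]′ (⊨-∨ .to h)))
      (∇-glue (proj₂ (∈-∧ .to v)) φψ ψχ)

    Represents : Form → ℕ → Set
    Represents φ n = Viable (decode n) × φ ∼ decode n

    least-representative : ∀ {φ} → Viable φ → ∃ (Least (Represents φ))
    least-representative {φ} v = least (code φ) (subst Viable (sym (decode-code φ)) v ,
                                                   subst (φ ∼_) (sym (decode-code φ)) (∼-refl v))

    index : Form → Maybe ℕ
    index φ with em {Viable φ}
    ... | yes v = just (proj₁ (least-representative v))
    ... | no _  = nothing

    index-defined : ∀ φ → (¬ index φ ≡ nothing) ⇔ Viable φ
    index-defined φ with em {Viable φ}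
    ... | yes v = mk⇔ (λ _ → v) (λ _ ())
    ... | no ¬v = mk⇔ (λ h → ⊥-elim (h refl)) (⊥-elim ∘ ¬v)

    index-≡ : ∀ φ ψ {n m} → index φ ≡ just n → index ψ ≡ just m → (n ≡ m) ⇔ (φ ∼ ψ)
    index-≡ φ ψ eφ eψ with em {Viable φ} | em {Viable ψ}
    index-≡ φ ψ refl refl | yes vφ | yes vψ = mk⇔ same-index same-class
      where
      same-index : proj₁ (least-representative vφ) ≡ proj₁ (least-representative vψ) → φ ∼ ψ
      same-index e with least-representative vφ | least-representative vψ
      same-index refl | n , (vn , φn) , _ | .n , (_ , ψn) , _ = ∼-trans vn φn (∼-sym ψn)
      same-class : φ ∼ ψ → proj₁ (least-representative vφ) ≡ proj₁ (least-representative vψ)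
      same-class φψ = Least-unique (λ (vn , φn) → vn , ∼-trans vφ (∼-sym φψ) φn)
                                   (λ (vn , ψn) → vn , ∼-trans vψ φψ ψn)
                                   (proj₂ (least-representative vφ)) (proj₂ (least-representative vψ))

  canonical : (Δ : FSet) → MaxCons Δ → (Const → ℕ) → SC
  canonical Δ mc f = record
    { Γ = Δ ; f = f ; g = λ i φ d → CanonicalIndex.index mc i d φ ; mcs = mc
    ; cond1 = λ i φ d → CanonicalIndex.index-defined mc i d φ
    ; cond2 = λ i φ ψ d n m → CanonicalIndex.index-≡ mc i d φ ψ }

  module Successor (s : SC) (i : Agent) {Σ₀ : FSet} (c : Consistent (unbox i (Γ s) ∪ Σ₀)) (n₀ : ℕ) where
    open MaxConsistent (mcs s)

    Δ : FSet
    Δ = proj₁ (lindenbaum c)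

    base⊆Δ : (unbox i (Γ s) ∪ Σ₀) ⊆ Δ
    base⊆Δ = proj₁ (proj₂ (lindenbaum c))

    Δ-maxCons : MaxCons Δ
    Δ-maxCons = proj₂ (proj₂ (lindenbaum c))

    module Δ = MaxConsistent Δ-maxCons

    ◇-of-∈ : ∀ {φ} → φ ∈ Δ → ◇ i φ ∈ Γ s
    ◇-of-∈ {φ} φ∈Δ with ∈-complete (mcs s) (◇ i φ)
    ... | inj₁ ◇φ  = ◇φ
    ... | inj₂ ¬◇φ = ⊥-elim (Δ.∈-¬ (base⊆Δ _ (inj₁ □¬φ)) φ∈Δ)
      where
      □¬φ : □ i (¬' φ) ∈ Γ s
      □¬φ = ∈-valid (¬◇φ ∷ []) λ { (h ∷ []) → ⊨-stable (⊨-¬ .to h ∘ ⊨-¬ .from) }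

    index-of-∈ : ∀ {φ d} → ∇ i φ d ∈ Γ s → φ ∈ Δ → ∃ λ n → g s i φ d ≡ just n
    index-of-∈ {φ} {d} ∇φ φ∈Δ with g s i φ d in gφ
    ... | just n  = n , refl
    ... | nothing = ⊥-elim (cond1 s i φ d .from (∈-∧ .from (∇φ , ◇-of-∈ φ∈Δ)) gφ)

    index-agrees : ∀ {φ φ′ d} → ∇ i φ d ∈ Γ s → φ ∈ Δ → ∇ i φ′ d ∈ Γ s → φ′ ∈ Δ →
                   g s i φ d ≡ g s i φ′ d
    index-agrees {φ} {φ′} {d} ∇φ φ∈Δ ∇φ′ φ′∈Δ
      with index-of-∈ ∇φ φ∈Δ | index-of-∈ ∇φ′ φ′∈Δ
    ... | n , gφ | m , gφ′ = trans gφ (trans (cong just n≡m) (sym gφ′))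
      where
      n≡m : n ≡ m
      n≡m = cond2 s i φ φ′ d n m gφ gφ′ .from
              (∇-join (◇-of-∈ (Δ.∈-∧ .from (φ∈Δ , φ′∈Δ))) ∇φ ∇φ′)

    Witness : Const → Set
    Witness d = ∃ λ φ → ∇ i φ d ∈ Γ s × φ ∈ Δ

    value : Const → ℕ
    value d with em {Witness d}
    ... | yes (_ , ∇φ , φ∈Δ) = proj₁ (index-of-∈ ∇φ φ∈Δ)
    ... | no _               = n₀

    value-agrees : ∀ {φ d} → ∇ i φ d ∈ Γ s → φ ∈ Δ → g s i φ d ≡ just (value d)
    value-agrees {φ} {d} ∇φ φ∈Δ with em {Witness d}
    ... | yes (_ , ∇φ′ , φ′∈Δ) = trans (index-agrees ∇φ φ∈Δ ∇φ′ φ′∈Δ) (proj₂ (index-of-∈ ∇φ′ φ′∈Δ))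
    ... | no ∄                 = ⊥-elim (∄ (φ , ∇φ , φ∈Δ))

    value-cases : ∀ d → value d ≡ n₀ ⊎ ∃ λ φ → φ ∈ Δ × g s i φ d ≡ just (value d)
    value-cases d with em {Witness d}
    ... | yes (φ , ∇φ , φ∈Δ) = inj₂ (φ , φ∈Δ , proj₂ (index-of-∈ ∇φ φ∈Δ))
    ... | no _               = inj₁ refl

    state : SC
    state = canonical Δ Δ-maxCons value

    accessible : Rc i s state
    accessible = (λ φ □φ → base⊆Δ φ (inj₁ □φ)) , λ φ d ∇φ φ∈Δ → sym (value-agrees ∇φ φ∈Δ)

    Σ₀⊆ : Σ₀ ⊆ Γ state
    Σ₀⊆ φ x = base⊆Δ φ (inj₂ x)

lemma2 : ExcludedMiddle 0ℓ →
    ∀ (s : SC) (i : Agent) (ψ : Form) (d : Const) →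
    (¬' ∇ i ψ d) ∈ Γ s →
    Σ SC λ t₁ → Σ SC λ t₂ →
    (ψ ∈ Γ t₁) × (ψ ∈ Γ t₂) × Rc i s t₁ × Rc i s t₂ × ¬ (f t₁ d ≡ f t₂ d)
lemma2 em s i ψ d ¬∇ψ =
  T₁.state , T₂.state , T₁.Σ₀⊆ ψ refl , T₂.Σ₀⊆ ψ (inj₁ refl) , T₁.accessible , T₂.accessible , differ
  where
  open Classical em
  open IndexClass s i d

  -- Only ⁅ ψ ⁆ is kept here, so the index 0 is immaterial.
  ψ-consistent : Consistent (unbox i (Γ s) ∪ ⁅ ψ ⁆)
  ψ-consistent = consistent-⊆ (λ _ → [ inj₁ , inj₂ ∘ inj₁ ]′) (candidate-consistent 0 ¬∇ψ)

  module T₁ = Successor s i ψ-consistent 0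

  v₀ : ℕ
  v₀ = f T₁.state d

  module T₂ = Successor s i (candidate-consistent v₀ ¬∇ψ) (suc v₀)

  differ : ¬ v₀ ≡ f T₂.state d
  differ v₀≡ = [ (λ ≡suc → 1+n≢n (sym (trans v₀≡ ≡suc)))
               , (λ (φ , φ∈Δ , gφ) → T₂.Δ.∈-¬ (T₂.Σ₀⊆ _ (inj₂ (φ , trans gφ (cong just (sym v₀≡)) , refl))) φ∈Δ)
               ]′ (T₂.value-cases d)
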